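{- The superintuitionistic logic $\mathsf{LC}$ is $2$-uniform: every propositional formula $\varphi$ is equivalent over $\mathsf{LC}$ to a formula of implication rank at most $2$.
   Context: $\mathsf{LC}$ is the extension of intuitionistic propositional logic $\mathsf{IPC}$ by the axiom $(p\to q)\vee(q\to p)$ (G\"odel–Dummett logic). The implication rank of a formula is the maximal nesting depth of the connective $\to$ in it (propositional variables and constants have rank $0$; $\wedge,\vee$ take the maximum; $\psi\to\chi$ has rank one more than the maximum of the ranks of $\psi,\chi$). A superintuitionistic logic $L$ is $n$-uniform if every formula is $L$-equivalent to a formula of implication rank $n$. -}

module Defs where

open import Data.Nat using (ℕ; suc; _⊔_)
open import Data.Product using (_×_)

data Form : Set where
  var  : ℕ → Form
  ⊥'   : Form
  ⊤'   : Form
  _∧'_ : Form → Form → Form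
  _∨'_ : Form → Form → Form
  _⇒_  : Form → Form → Form

infixr 6 _∧'_
infixr 5 _∨'_
infixr 4 _⇒_

rank : Form → ℕ
rank (var _)  = 0
rank ⊥'       = 0
rank ⊤'       = 0
rank (a ∧' b) = rank a ⊔ rank b
rank (a ∨' b) = rank a ⊔ rank b
rank (a ⇒ b)  = suc (rank a ⊔ rank b)

-- Hilbert-style calculus for LC: the standard axiom schemes of IPC
-- (schemes = closure under substitution), modus ponens, plus the
-- linearity scheme (A ⇒ B) ∨ (B ⇒ A).
data LC⊢_ : Form → Set where
  ax-K   : ∀ {a b}   → LC⊢ (a ⇒ b ⇒ a)
  ax-S   : ∀ {a b c} → LC⊢ ((a ⇒ b ⇒ c) ⇒ (a ⇒ b) ⇒ a ⇒ c)
  ax-∧E₁ : ∀ {a b}   → LC⊢ (a ∧' b ⇒ a)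
  ax-∧E₂ : ∀ {a b}   → LC⊢ (a ∧' b ⇒ b)
  ax-∧I  : ∀ {a b}   → LC⊢ (a ⇒ b ⇒ a ∧' b)
  ax-∨I₁ : ∀ {a b}   → LC⊢ (a ⇒ a ∨' b)
  ax-∨I₂ : ∀ {a b}   → LC⊢ (b ⇒ a ∨' b)
  ax-∨E  : ∀ {a b c} → LC⊢ ((a ⇒ c) ⇒ (b ⇒ c) ⇒ a ∨' b ⇒ c)
  ax-⊥   : ∀ {a}     → LC⊢ (⊥' ⇒ a)
  ax-⊤   : LC⊢ ⊤'
  ax-lin : ∀ {a b}   → LC⊢ ((a ⇒ b) ∨' (b ⇒ a))
  mp     : ∀ {a b}   → LC⊢ (a ⇒ b) → LC⊢ a → LC⊢ b

infix 2 LC⊢_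

_≡LC_ : Form → Form → Set
φ ≡LC ψ = LC⊢ ((φ ⇒ ψ) ∧' (ψ ⇒ φ))

-- Over LC the implication laws (a ∧ b ⇒ c) ≡ (a ⇒ c) ∨ (b ⇒ c) and
-- (a ⇒ b ∨ c) ≡ (a ⇒ b) ∨ (a ⇒ c) hold besides the intuitionistic ones, and with
-- currying they push every implication down until both sides are atoms or
-- implications between atoms.  The only formulas of rank 3 that remain are
-- ((x ⇒ y) ⇒ w) ⇒ z with atomic x, y, w, z, and for these linearity gives
--   ((x ⇒ y) ⇒ w) ⇒ z  ≡  z ∨ ((w ⇒ z) ∧ ((x ⇒ y) ∨ ((y ⇒ w) ⇒ w))),
-- which has rank 2.  Hence normal forms are ∧/∨-combinations of atoms a,
-- implications a ⇒ b and implications (a ⇒ b) ⇒ c.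
module Submission where

open import Defs
open import Data.Nat using (_≤_; z≤n; s≤s)
open import Data.Nat.Properties using (⊔-lub)
open import Data.List using (List; []; _∷_)
open import Data.List.Membership.Propositional using (_∈_)
open import Data.List.Relation.Unary.Any using (here; there)
open import Data.List.Relation.Binary.Subset.Propositional using (_⊆_)
open import Data.Product using (Σ; _×_; _,_)
open import Relation.Binary.PropositionalEquality using (refl)

infix 2 _⊢_
data _⊢_ (Γ : List Form) : Form → Set where
  hyp : ∀ {a} → a ∈ Γ → Γ ⊢ a
  thm : ∀ {a} → LC⊢ a → Γ ⊢ a
  app : ∀ {a b} → Γ ⊢ a ⇒ b → Γ ⊢ a → Γ ⊢ b

weaken : ∀ {Γ Δ a} → Γ ⊆ Δ → Γ ⊢ a → Δ ⊢ a
weaken Γ⊆Δ (hyp a∈Γ) = hyp (Γ⊆Δ a∈Γ)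
weaken Γ⊆Δ (thm d)   = thm d
weaken Γ⊆Δ (app d e) = app (weaken Γ⊆Δ d) (weaken Γ⊆Δ e)

closed : ∀ {a} → [] ⊢ a → LC⊢ a
closed (hyp ())
closed (thm d)   = d
closed (app d e) = mp (closed d) (closed e)

deduction : ∀ {Γ a b} → a ∷ Γ ⊢ b → Γ ⊢ a ⇒ b
deduction {a = a} (hyp (here refl)) = app (app (thm ax-S) (thm (ax-K {b = a ⇒ a}))) (thm ax-K)
deduction (hyp (there b∈Γ)) = app (thm ax-K) (hyp b∈Γ)
deduction (thm d)           = app (thm ax-K) (thm d)
deduction (app d e)         = app (app (thm ax-S) (deduction d)) (deduction e)

module _ {Γ : List Form} where

  ∧-intro : ∀ {a b} → Γ ⊢ a → Γ ⊢ b → Γ ⊢ a ∧' b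
  ∧-intro d e = app (app (thm ax-∧I) d) e

  ∧-elim₁ : ∀ {a b} → Γ ⊢ a ∧' b → Γ ⊢ a
  ∧-elim₁ = app (thm ax-∧E₁)

  ∧-elim₂ : ∀ {a b} → Γ ⊢ a ∧' b → Γ ⊢ b
  ∧-elim₂ = app (thm ax-∧E₂)

  ∨-intro₁ : ∀ {a b} → Γ ⊢ a → Γ ⊢ a ∨' b
  ∨-intro₁ = app (thm ax-∨I₁)

  ∨-intro₂ : ∀ {a b} → Γ ⊢ b → Γ ⊢ a ∨' b
  ∨-intro₂ = app (thm ax-∨I₂)

  ∨-elim : ∀ {a b c} → Γ ⊢ a ∨' b → a ∷ Γ ⊢ c → b ∷ Γ ⊢ c → Γ ⊢ c
  ∨-elim d e f = app (app (app (thm ax-∨E) (deduction e)) (deduction f)) d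

  linearity : ∀ a b → Γ ⊢ (a ⇒ b) ∨' (b ⇒ a)
  linearity a b = thm ax-lin

  app-closed : ∀ {a b} → [] ⊢ a ⇒ b → Γ ⊢ a → Γ ⊢ b
  app-closed f = app (weaken (λ ()) f)

#0 : ∀ {a Γ} → a ∷ Γ ⊢ a
#0 = hyp (here refl)

#1 : ∀ {a b Γ} → b ∷ a ∷ Γ ⊢ a
#1 = hyp (there (here refl))

#2 : ∀ {a b c Γ} → c ∷ b ∷ a ∷ Γ ⊢ a
#2 = hyp (there (there (here refl)))

#3 : ∀ {a b c d Γ} → d ∷ c ∷ b ∷ a ∷ Γ ⊢ a
#3 = hyp (there (there (there (here refl))))

infix 1 _≈_
_≈_ : Form → Form → Set
a ≈ b = ([] ⊢ a ⇒ b) × ([] ⊢ b ⇒ a)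

≈⇒≡LC : ∀ {a b} → a ≈ b → a ≡LC b
≈⇒≡LC (to , from) = closed (∧-intro to from)

≈-refl : ∀ {a} → a ≈ a
≈-refl = deduction #0 , deduction #0

≈-trans : ∀ {a b c} → a ≈ b → b ≈ c → a ≈ c
≈-trans (f , g) (h , k) =
  deduction (app-closed h (app-closed f #0)) , deduction (app-closed g (app-closed k #0))

∧-cong : ∀ {a a' b b'} → a ≈ a' → b ≈ b' → a ∧' b ≈ a' ∧' b'
∧-cong (f₁ , g₁) (f₂ , g₂) =
  deduction (∧-intro (app-closed f₁ (∧-elim₁ #0)) (app-closed f₂ (∧-elim₂ #0))) ,
  deduction (∧-intro (app-closed g₁ (∧-elim₁ #0)) (app-closed g₂ (∧-elim₂ #0)))

∨-cong : ∀ {a a' b b'} → a ≈ a' → b ≈ b' → a ∨' b ≈ a' ∨' b'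
∨-cong (f₁ , g₁) (f₂ , g₂) =
  deduction (∨-elim #0 (∨-intro₁ (app-closed f₁ #0)) (∨-intro₂ (app-closed f₂ #0))) ,
  deduction (∨-elim #0 (∨-intro₁ (app-closed g₁ #0)) (∨-intro₂ (app-closed g₂ #0)))

⇒-cong : ∀ {a a' b b'} → a ≈ a' → b ≈ b' → (a ⇒ b) ≈ (a' ⇒ b')
⇒-cong (f₁ , g₁) (f₂ , g₂) =
  deduction (deduction (app-closed f₂ (app #1 (app-closed g₁ #0)))) ,
  deduction (deduction (app-closed g₂ (app #1 (app-closed f₁ #0))))

⇒-distribˡ-∧ : ∀ {a b c} → (a ⇒ b ∧' c) ≈ (a ⇒ b) ∧' (a ⇒ c)
⇒-distribˡ-∧ =
  deduction (∧-intro (deduction (∧-elim₁ (app #1 #0))) (deduction (∧-elim₂ (app #1 #0)))) ,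
  deduction (deduction (∧-intro (app (∧-elim₁ #1) #0) (app (∧-elim₂ #1) #0)))

∨-⇒-to-∧ : ∀ {a b c} → (a ∨' b ⇒ c) ≈ (a ⇒ c) ∧' (b ⇒ c)
∨-⇒-to-∧ =
  deduction (∧-intro (deduction (app #1 (∨-intro₁ #0))) (deduction (app #1 (∨-intro₂ #0)))) ,
  deduction (deduction (∨-elim #0 (app (∧-elim₁ #2) #0) (app (∧-elim₂ #2) #0)))

∧-⇒-to-∨ : ∀ {a b c} → (a ∧' b ⇒ c) ≈ (a ⇒ c) ∨' (b ⇒ c)
∧-⇒-to-∨ {a} {b} =
  deduction (∨-elim (linearity a b)
    (∨-intro₁ (deduction (app #2 (∧-intro #0 (app #1 #0)))))
    (∨-intro₂ (deduction (app #2 (∧-intro (app #1 #0) #0))))) ,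
  deduction (deduction (∨-elim #1 (app #0 (∧-elim₁ #1)) (app #0 (∧-elim₂ #1))))

⇒-distribˡ-∨ : ∀ {a b c} → (a ⇒ b ∨' c) ≈ (a ⇒ b) ∨' (a ⇒ c)
⇒-distribˡ-∨ {a} {b} {c} =
  deduction (∨-elim (linearity b c)
    (∨-intro₂ (deduction (∨-elim (app #2 #0) (app #2 #0) #0)))
    (∨-intro₁ (deduction (∨-elim (app #2 #0) #0 (app #2 #0))))) ,
  deduction (deduction (∨-elim #1 (∨-intro₁ (app #0 #1)) (∨-intro₂ (app #0 #1))))

curry : ∀ {a b c} → (a ⇒ b ⇒ c) ≈ (a ∧' b ⇒ c)
curry =
  deduction (deduction (app (app #1 (∧-elim₁ #0)) (∧-elim₂ #0))) ,
  deduction (deduction (deduction (app #2 (∧-intro #1 #0))))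

⇒-⇒-to-∨ : ∀ {a b c} → (a ⇒ b ⇒ c) ≈ (a ⇒ c) ∨' (b ⇒ c)
⇒-⇒-to-∨ = ≈-trans curry ∧-⇒-to-∨

⇒-or-⇒⇒ : ∀ {Γ} a b → Γ ⊢ (a ⇒ b) ∨' ((a ⇒ b) ⇒ b)
⇒-or-⇒⇒ a b = ∨-elim (linearity a (a ⇒ b))
  (∨-intro₁ (deduction (app (app #1 #0) #0)))
  (∨-intro₂ (deduction (app #0 (app #1 #0))))

-- Splitting on (x ⇒ y) ∨ ((x ⇒ y) ⇒ y) and (y ⇒ w) ∨ ((y ⇒ w) ⇒ w): the first
-- disjunct is kept, the last leaves (y ⇒ w) ⇒ w, and in the middle case
-- (x ⇒ y) ⇒ y and y ⇒ w give (x ⇒ y) ⇒ w, hence z.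
⇒⇒⇒-to-rank2 : ∀ {x y w z} →
  (((x ⇒ y) ⇒ w) ⇒ z) ≈ z ∨' ((w ⇒ z) ∧' ((x ⇒ y) ∨' ((y ⇒ w) ⇒ w)))
⇒⇒⇒-to-rank2 {x} {y} {w} {z} =
  deduction (∨-elim cases (∨-intro₁ #0) (∨-intro₂ (∧-intro (weaken there w⇒z) #0))) ,
  deduction (deduction (∨-elim #1 #0 (app (∧-elim₁ #0)
    (∨-elim (∧-elim₂ #0) (app #2 #0) (app #0 (deduction (app #3 (deduction #1))))))))
  where
  w⇒z : (((x ⇒ y) ⇒ w) ⇒ z) ∷ [] ⊢ w ⇒ z
  w⇒z = deduction (app #1 (deduction #1))

  cases : (((x ⇒ y) ⇒ w) ⇒ z) ∷ [] ⊢ z ∨' ((x ⇒ y) ∨' ((y ⇒ w) ⇒ w))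
  cases = ∨-elim (⇒-or-⇒⇒ x y) (∨-intro₂ (∨-intro₁ #0))
    (∨-elim (⇒-or-⇒⇒ y w) (∨-intro₁ (app #2 (deduction (app #1 (app #2 #0)))))
                           (∨-intro₂ (∨-intro₂ #0)))

data Atom : Form → Set where
  var : ∀ n → Atom (var n)
  ⊥'  : Atom ⊥'
  ⊤'  : Atom ⊤'

data Basic : Form → Set where
  atom    : ∀ {x} → Atom x → Basic x
  imp     : ∀ {x y} → Atom x → Atom y → Basic (x ⇒ y)
  imp-imp : ∀ {x y z} → Atom x → Atom y → Atom z → Basic ((x ⇒ y) ⇒ z)

data NF : Form → Set where
  basic : ∀ {a} → Basic a → NF a
  _∧ⁿ_  : ∀ {a b} → NF a → NF b → NF (a ∧' b)
  _∨ⁿ_  : ∀ {a b} → NF a → NF b → NF (a ∨' b)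

atom-rank : ∀ {x n} → Atom x → rank x ≤ n
atom-rank (var _) = z≤n
atom-rank ⊥'      = z≤n
atom-rank ⊤'      = z≤n

basic-rank : ∀ {a} → Basic a → rank a ≤ 2
basic-rank (atom x)        = atom-rank x
basic-rank (imp x y)       = s≤s (⊔-lub (atom-rank x) (atom-rank y))
basic-rank (imp-imp x y z) =
  s≤s (⊔-lub (s≤s (⊔-lub (atom-rank x) (atom-rank y))) (atom-rank z))

NF-rank : ∀ {a} → NF a → rank a ≤ 2
NF-rank (basic b) = basic-rank b
NF-rank (p ∧ⁿ q)  = ⊔-lub (NF-rank p) (NF-rank q)
NF-rank (p ∨ⁿ q)  = ⊔-lub (NF-rank p) (NF-rank q)

record Normalised (φ : Form) : Set where
  constructor normalised
  field
    {form} : Form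
    isNF   : NF form
    equiv  : φ ≈ form

basicⁿ : ∀ {a} → Basic a → Normalised a
basicⁿ b = normalised (basic b) ≈-refl

via : ∀ {φ χ} → φ ≈ χ → Normalised χ → Normalised φ
via e (normalised n f) = normalised n (≈-trans e f)

_∧ᴺ_ : ∀ {a b} → Normalised a → Normalised b → Normalised (a ∧' b)
normalised n e ∧ᴺ normalised m f = normalised (n ∧ⁿ m) (∧-cong e f)

_∨ᴺ_ : ∀ {a b} → Normalised a → Normalised b → Normalised (a ∨' b)
normalised n e ∨ᴺ normalised m f = normalised (n ∨ⁿ m) (∨-cong e f)

normalise-⇒-atom : ∀ {ψ z} → NF ψ → Atom z → Normalised (ψ ⇒ z)
normalise-⇒-atom (basic (atom x))      z = basicⁿ (imp x z)
normalise-⇒-atom (basic (imp x y))     z = basicⁿ (imp-imp x y z)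
normalise-⇒-atom (basic (imp-imp x y w)) z =
  via ⇒⇒⇒-to-rank2
    (basicⁿ (atom z) ∨ᴺ (basicⁿ (imp w z) ∧ᴺ (basicⁿ (imp x y) ∨ᴺ basicⁿ (imp-imp y w w))))
normalise-⇒-atom (p ∧ⁿ q) z = via ∧-⇒-to-∨ (normalise-⇒-atom p z ∨ᴺ normalise-⇒-atom q z)
normalise-⇒-atom (p ∨ⁿ q) z = via ∨-⇒-to-∧ (normalise-⇒-atom p z ∧ᴺ normalise-⇒-atom q z)

normalise-⇒ : ∀ {ψ χ} → NF ψ → NF χ → Normalised (ψ ⇒ χ)
normalise-⇒ p (basic (atom z))        = normalise-⇒-atom p z
normalise-⇒ p (basic (imp x y))       = via ⇒-⇒-to-∨ (normalise-⇒-atom p y ∨ᴺ basicⁿ (imp x y))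
normalise-⇒ p (basic (imp-imp x y w)) = via ⇒-⇒-to-∨ (normalise-⇒-atom p w ∨ᴺ basicⁿ (imp-imp x y w))
normalise-⇒ p (q ∧ⁿ r) = via ⇒-distribˡ-∧ (normalise-⇒ p q ∧ᴺ normalise-⇒ p r)
normalise-⇒ p (q ∨ⁿ r) = via ⇒-distribˡ-∨ (normalise-⇒ p q ∨ᴺ normalise-⇒ p r)

normalise : (φ : Form) → Normalised φ
normalise (var n)  = basicⁿ (atom (var n))
normalise ⊥'       = basicⁿ (atom ⊥')
normalise ⊤'       = basicⁿ (atom ⊤')
normalise (a ∧' b) = normalise a ∧ᴺ normalise b
normalise (a ∨' b) = normalise a ∨ᴺ normalise b
normalise (a ⇒ b) with normalise a | normalise b
... | normalised p e | normalised q f = via (⇒-cong e f) (normalise-⇒ p q)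

mainTheorem16 : (φ : Form) → Σ Form (λ ψ → (rank ψ ≤ 2) × (φ ≡LC ψ))
mainTheorem16 φ = form , NF-rank isNF , ≈⇒≡LC equiv
  where open Normalised (normalise φ)
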